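{- Let $A_1,\dots,A_n,A$ be formulas of $LM2$. If $A_1,\dots,A_n\vdash_{LM2}A$, then $A_1^*,\dots,A_n^*\vdash_{LAF2}A^*$.
   Context: Formulas: second-order predicate logic built from $\perp$ and atomic formulas $R(t_1,\dots,t_k)$ ($R$ a predicate symbol or predicate variable, $t_i$ first-order terms) with $\rightarrow,\forall x,\forall X$; $\neg A=A\rightarrow\perp$; equations $u=v$ abbreviate $\forall Y(Y(u)\rightarrow Y(v))$, a fixed set of equations is given and $a\approx b$ means $a=b$ is a consequence of it. $LAF2$ is second-order intuitionistic natural deduction with rules: hypothesis, $\rightarrow$-intro/elim, $\forall x$-intro (eigenvariable condition)/elim (any term), $\forall X$-intro (eigenvariable)/elim (any formula), and the equational rule (from $A[u/x]$ and $u\approx v$ derive $A[v/x]$). $LM2$ has, in addition, for each arity a countable set of classical predicate variables $X_C$; a formula ends with $X$ if it is $X(\vec t)$, or $A\rightarrow B$ with $B$ ending with $X$, or $\forall vA$ with $A$ ending with $X$; a classical type is a formula ending with $\perp$ or a classical variable. $LM2$ = rules of $LAF2$ plus the axiom $\forall X_C\{\neg\neg X_C\rightarrow X_C\}$, $\forall X_C$-introduction (eigenvariable condition) and $\forall X_C$-elimination instantiating $X_C$ only by classical types. Gödel translation: to each classical variable $X_C$ associate a fresh ordinary predicate variable $X^*$ of the same arity; for a formula $A$ of $LM2$ define $A^*$ by: $D(\vec t)^*=D(\vec t)$ for $D$ a predicate symbol, ordinary predicate variable, or $\perp$; $X_C(\vec t)^*=\neg X^*(\vec t)$; $(B\rightarrow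 C)^*=B^*\rightarrow C^*$; $(\forall xB)^*=\forall xB^*$; $(\forall XB)^*=\forall XB^*$; $(\forall X_CB)^*=\forall X^*B^*$. -}

module Defs where

open import Data.Nat using (ℕ; zero; suc; _+_)
open import Data.Fin using (Fin; zero; suc; _↑ˡ_; _↑ʳ_; splitAt)
open import Data.Vec using (Vec; []; _∷_; tabulate; lookup)
open import Data.Vec.Relation.Binary.Pointwise.Inductive using (Pointwise)
open import Data.List using (List; []; _∷_; _++_; map)
open import Data.List.Membership.Propositional using (_∈_)
open import Data.Sum using (inj₁; inj₂; [_,_]′)

record Signature : Set₁ where
  field
    Fun    : Set
    funAr  : Fun → ℕ
    Pred   : Set
    predAr : Pred → ℕ

open Signature public

data Term (S : Signature) (n : ℕ) : Set where
  var : Fin n → Term S n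
  app : (f : Fun S) → Vec (Term S n) (funAr S f) → Term S n

module _ {S : Signature} where
  mutual
    substT : ∀ {n m} → (Fin n → Term S m) → Term S n → Term S m
    substT σ (var i)    = σ i
    substT σ (app f ts) = app f (substTs σ ts)

    substTs : ∀ {n m k} → (Fin n → Term S m) → Vec (Term S n) k → Vec (Term S m) k
    substTs σ []       = []
    substTs σ (t ∷ ts) = substT σ t ∷ substTs σ ts

  renT : ∀ {n m} → (Fin n → Fin m) → Term S n → Term S m
  renT ρ = substT (λ i → var (ρ i))

  liftT : ∀ {n m} → (Fin n → Term S m) → Fin (suc n) → Term S (suc m)
  liftT σ zero    = var zero
  liftT σ (suc i) = renT suc (σ i)

  bvars : ∀ k n → Vec (Term S (k + n)) k
  bvars k n = tabulate (λ i → var (i ↑ˡ n))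

record EqTheory (S : Signature) : Set₁ where
  field
    Ax     : Set
    axVars : Ax → ℕ
    lhs    : (e : Ax) → Term S (axVars e)
    rhs    : (e : Ax) → Term S (axVars e)

open EqTheory public

module _ {S : Signature} (E : EqTheory S) where
  data _≈_ {n : ℕ} : Term S n → Term S n → Set where
    ax     : (e : Ax E) (σ : Fin (axVars E e) → Term S n) →
             substT σ (lhs E e) ≈ substT σ (rhs E e)
    refl≈  : ∀ {t} → t ≈ t
    sym≈   : ∀ {t u} → t ≈ u → u ≈ t
    trans≈ : ∀ {t u v} → t ≈ u → u ≈ v → t ≈ v
    cong≈  : (f : Fun S) {ts us : Vec (Term S n) (funAr S f)} →
             Pointwise _≈_ ts us → app f ts ≈ app f us

-- Typed de Bruijn variables for predicate variables (lists of arities)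

data Var : List ℕ → ℕ → Set where
  here  : ∀ {k Δ} → Var (k ∷ Δ) k
  there : ∀ {k j Δ} → Var Δ k → Var (j ∷ Δ) k

liftV : ∀ {Δ Δ' j} → (∀ {k} → Var Δ k → Var Δ' k) → ∀ {k} → Var (j ∷ Δ) k → Var (j ∷ Δ') k
liftV ρ here      = here
liftV ρ (there x) = there (ρ x)

inl : ∀ {Θ Δ k} → Var Θ k → Var (Θ ++ Δ) k
inl here      = here
inl (there x) = there (inl x)

inr : ∀ {Θ Δ k} → Var Δ k → Var (Θ ++ Δ) k
inr {[]}    x = x
inr {_ ∷ Θ} x = there (inr {Θ} x)


-- Formulas.  Logic AF = LAF2 (no classical variables), M = LM2.
-- Formula S L n Δ Θ : n term variables, ordinary predicate variables
-- with arities Δ, classical predicate variables with arities Θ.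

data Logic : Set where
  AF M : Logic

infixr 5 _⇒_

data Formula (S : Signature) : Logic → ℕ → List ℕ → List ℕ → Set where
  ⊥'  : ∀ {L n Δ Θ} → Formula S L n Δ Θ
  rel : ∀ {L n Δ Θ} (P : Pred S) → Vec (Term S n) (predAr S P) → Formula S L n Δ Θ
  pv  : ∀ {L n Δ Θ k} → Var Δ k → Vec (Term S n) k → Formula S L n Δ Θ
  cv  : ∀ {n Δ Θ k} → Var Θ k → Vec (Term S n) k → Formula S M n Δ Θ
  _⇒_ : ∀ {L n Δ Θ} → Formula S L n Δ Θ → Formula S L n Δ Θ → Formula S L n Δ Θ
  ∀₁  : ∀ {L n Δ Θ} → Formula S L (suc n) Δ Θ → Formula S L n Δ Θ
  ∀₂  : ∀ {L n Δ Θ} (k : ℕ) → Formula S L n (k ∷ Δ) Θ → Formula S L n Δ Θ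
  ∀c  : ∀ {n Δ Θ} (k : ℕ) → Formula S M n Δ (k ∷ Θ) → Formula S M n Δ Θ

module _ {S : Signature} where

  ¬' : ∀ {L n Δ Θ} → Formula S L n Δ Θ → Formula S L n Δ Θ
  ¬' A = A ⇒ ⊥'

  ∀ⁿ : ∀ {L n Δ Θ} (k : ℕ) → Formula S L (k + n) Δ Θ → Formula S L n Δ Θ
  ∀ⁿ zero    A = A
  ∀ⁿ (suc k) A = ∀ⁿ k (∀₁ A)

  substF : ∀ {L n m Δ Θ} → (Fin n → Term S m) → Formula S L n Δ Θ → Formula S L m Δ Θ
  substF σ ⊥'         = ⊥'
  substF σ (rel P ts) = rel P (substTs σ ts)
  substF σ (pv x ts)  = pv x (substTs σ ts)
  substF σ (cv x ts)  = cv x (substTs σ ts)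
  substF σ (A ⇒ B)    = substF σ A ⇒ substF σ B
  substF σ (∀₁ A)     = ∀₁ (substF (liftT σ) A)
  substF σ (∀₂ k A)   = ∀₂ k (substF σ A)
  substF σ (∀c k A)   = ∀c k (substF σ A)

  renP : ∀ {L n Δ Δ' Θ} → (∀ {k} → Var Δ k → Var Δ' k) → Formula S L n Δ Θ → Formula S L n Δ' Θ
  renP ρ ⊥'         = ⊥'
  renP ρ (rel P ts) = rel P ts
  renP ρ (pv x ts)  = pv (ρ x) ts
  renP ρ (cv x ts)  = cv x ts
  renP ρ (A ⇒ B)    = renP ρ A ⇒ renP ρ B
  renP ρ (∀₁ A)     = ∀₁ (renP ρ A)
  renP ρ (∀₂ k A)   = ∀₂ k (renP (liftV ρ) A)
  renP ρ (∀c k A)   = ∀c k (renP ρ A)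

  renC : ∀ {n Δ Θ Θ'} → (∀ {k} → Var Θ k → Var Θ' k) → Formula S M n Δ Θ → Formula S M n Δ Θ'
  renC ρ ⊥'         = ⊥'
  renC ρ (rel P ts) = rel P ts
  renC ρ (pv x ts)  = pv x ts
  renC ρ (cv x ts)  = cv (ρ x) ts
  renC ρ (A ⇒ B)    = renC ρ A ⇒ renC ρ B
  renC ρ (∀₁ A)     = ∀₁ (renC ρ A)
  renC ρ (∀₂ k A)   = ∀₂ k (renC ρ A)
  renC ρ (∀c k A)   = ∀c k (renC (liftV ρ) A)

  -- applying an abstraction λx₁…x_k.B (B with k extra leading term
  -- variables) to argument terms ts
  apply : ∀ {L n k Δ Θ} → Formula S L (k + n) Δ Θ → Vec (Term S n) k → Formula S L n Δ Θ
  apply {n = n} {k = k} B ts = substF (λ i → [ lookup ts , var ]′ (splitAt k i)) B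

  wkAbs : ∀ {L n k Δ Θ} → Formula S L (k + n) Δ Θ → Formula S L (k + suc n) Δ Θ
  wkAbs {n = n} {k = k} B =
    substF (λ i → [ (λ j → var (j ↑ˡ suc n)) , (λ j → var (k ↑ʳ suc j)) ]′ (splitAt k i)) B

  substP : ∀ {L n Δ Δ' Θ} → (∀ {k} → Var Δ k → Formula S L (k + n) Δ' Θ) →
           Formula S L n Δ Θ → Formula S L n Δ' Θ
  substP σ ⊥'         = ⊥'
  substP σ (rel P ts) = rel P ts
  substP σ (pv x ts)  = apply (σ x) ts
  substP σ (cv x ts)  = cv x ts
  substP σ (A ⇒ B)    = substP σ A ⇒ substP σ B
  substP σ (∀₁ A)     = ∀₁ (substP (λ x → wkAbs (σ x)) A)
  substP {n = n} σ (∀₂ j A) = ∀₂ j (substP σ' A)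
    where
      σ' : ∀ {k} → Var (j ∷ _) k → Formula S _ (k + n) (j ∷ _) _
      σ' {k} here = pv here (bvars k n)
      σ' (there x) = renP there (σ x)
  substP σ (∀c j A)   = ∀c j (substP (λ x → renC there (σ x)) A)

  substC : ∀ {n Δ Θ Θ'} → (∀ {k} → Var Θ k → Formula S M (k + n) Δ Θ') →
           Formula S M n Δ Θ → Formula S M n Δ Θ'
  substC σ ⊥'         = ⊥'
  substC σ (rel P ts) = rel P ts
  substC σ (pv x ts)  = pv x ts
  substC σ (cv x ts)  = apply (σ x) ts
  substC σ (A ⇒ B)    = substC σ A ⇒ substC σ B
  substC σ (∀₁ A)     = ∀₁ (substC (λ x → wkAbs (σ x)) A)
  substC σ (∀₂ j A)   = ∀₂ j (substC (λ x → renP there (σ x)) A)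
  substC {n = n} σ (∀c j A) = ∀c j (substC σ' A)
    where
      σ' : ∀ {k} → Var (j ∷ _) k → Formula S M (k + n) _ (j ∷ _)
      σ' {k} here = cv here (bvars k n)
      σ' (there x) = renC there (σ x)

  inst₁ : ∀ {L n Δ Θ} → Formula S L (suc n) Δ Θ → Term S n → Formula S L n Δ Θ
  inst₁ A t = substF (λ { zero → t ; (suc i) → var i }) A

  inst₂ : ∀ {L n k Δ Θ} → Formula S L n (k ∷ Δ) Θ → Formula S L (k + n) Δ Θ → Formula S L n Δ Θ
  inst₂ {n = n} A B = substP σ A
    where
      σ : ∀ {j} → Var (_ ∷ _) j → Formula S _ (j + n) _ _
      σ here = B
      σ {j} (there x) = pv x (bvars j n)

  instC : ∀ {n k Δ Θ} → Formula S M n Δ (k ∷ Θ) → Formula S M (k + n) Δ Θ → Formula S M n Δ Θ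
  instC {n = n} A B = substC σ A
    where
      σ : ∀ {j} → Var (_ ∷ _) j → Formula S M (j + n) _ _
      σ here = B
      σ {j} (there x) = cv x (bvars j n)

  wk₁ : ∀ {L n Δ Θ} → Formula S L n Δ Θ → Formula S L (suc n) Δ Θ
  wk₁ = substF (λ i → var (suc i))

  wk₂ : ∀ {L n Δ Θ k} → Formula S L n Δ Θ → Formula S L n (k ∷ Δ) Θ
  wk₂ = renP there

  wkC : ∀ {n Δ Θ k} → Formula S M n Δ Θ → Formula S M n Δ (k ∷ Θ)
  wkC = renC there

  data ClassicalType : ∀ {n Δ Θ} → Formula S M n Δ Θ → Set where
    ct⊥  : ∀ {n Δ Θ} → ClassicalType {n} {Δ} {Θ} ⊥'
    ctcv : ∀ {n Δ Θ k} (x : Var Θ k) (ts : Vec (Term S n) k) → ClassicalType (cv {Δ = Δ} x ts)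
    ct⇒  : ∀ {n Δ Θ} {A B : Formula S M n Δ Θ} → ClassicalType B → ClassicalType (A ⇒ B)
    ct∀₁ : ∀ {n Δ Θ} {A : Formula S M (suc n) Δ Θ} → ClassicalType A → ClassicalType (∀₁ A)
    ct∀₂ : ∀ {n Δ Θ k} {A : Formula S M n (k ∷ Δ) Θ} → ClassicalType A → ClassicalType (∀₂ k A)
    ct∀c : ∀ {n Δ Θ k} {A : Formula S M n Δ (k ∷ Θ)} → ClassicalType A → ClassicalType (∀c k A)

  dneAxiom : ∀ {n Δ Θ} (k : ℕ) → Formula S M n Δ Θ
  dneAxiom {n} k = ∀c k (∀ⁿ k (¬' (¬' X) ⇒ X))
    where X = cv here (bvars k n)

-- Natural deduction.  Derivation E {AF} Γ A is ⊢_LAF2, Derivation E {M} Γ A is ⊢_LM2.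

module _ {S : Signature} (E : EqTheory S) where

  data Derivation : ∀ {L n Δ Θ} → List (Formula S L n Δ Θ) → Formula S L n Δ Θ → Set where
    hyp  : ∀ {L n Δ Θ} {Γ : List (Formula S L n Δ Θ)} {A} → A ∈ Γ → Derivation Γ A
    ⇒I   : ∀ {L n Δ Θ} {Γ : List (Formula S L n Δ Θ)} {A B} →
           Derivation (A ∷ Γ) B → Derivation Γ (A ⇒ B)
    ⇒E   : ∀ {L n Δ Θ} {Γ : List (Formula S L n Δ Θ)} {A B} →
           Derivation Γ (A ⇒ B) → Derivation Γ A → Derivation Γ B
    ∀₁I  : ∀ {L n Δ Θ} {Γ : List (Formula S L n Δ Θ)} {A} →
           Derivation (map wk₁ Γ) A → Derivation Γ (∀₁ A)
    ∀₁E  : ∀ {L n Δ Θ} {Γ : List (Formula S L n Δ Θ)} {A} →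
           Derivation Γ (∀₁ A) → (t : Term S n) → Derivation Γ (inst₁ A t)
    ∀₂I  : ∀ {L n Δ Θ k} {Γ : List (Formula S L n Δ Θ)} {A} →
           Derivation (map (wk₂ {k = k}) Γ) A → Derivation Γ (∀₂ k A)
    ∀₂E  : ∀ {L n Δ Θ k} {Γ : List (Formula S L n Δ Θ)} {A} →
           Derivation Γ (∀₂ k A) → (B : Formula S L (k + n) Δ Θ) → Derivation Γ (inst₂ A B)
    eqR  : ∀ {L n Δ Θ} {Γ : List (Formula S L n Δ Θ)} (A : Formula S L (suc n) Δ Θ) {u v} →
           Derivation Γ (inst₁ A u) → _≈_ E u v → Derivation Γ (inst₁ A v)
    dne  : ∀ {n Δ Θ} {Γ : List (Formula S M n Δ Θ)} (k : ℕ) → Derivation Γ (dneAxiom k)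
    ∀cI  : ∀ {n Δ Θ k} {Γ : List (Formula S M n Δ Θ)} {A} →
           Derivation (map (wkC {k = k}) Γ) A → Derivation Γ (∀c k A)
    ∀cE  : ∀ {n Δ Θ k} {Γ : List (Formula S M n Δ Θ)} {A} →
           Derivation Γ (∀c k A) → (B : Formula S M (k + n) Δ Θ) → ClassicalType B →
           Derivation Γ (instC A B)

-- Gödel translation.  Classical variables X_C (in Θ) are sent to fresh
-- ordinary variables X* ; at top level the target predicate context is Θ ++ Δ.

module _ {S : Signature} where

  trans : ∀ {L n Δ Θ Δ'} → (∀ {k} → Var Δ k → Var Δ' k) → (∀ {k} → Var Θ k → Var Δ' k) →
          Formula S L n Δ Θ → Formula S AF n Δ' []
  trans ρ χ ⊥'         = ⊥'
  trans ρ χ (rel P ts) = rel P ts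
  trans ρ χ (pv x ts)  = pv (ρ x) ts
  trans ρ χ (cv x ts)  = ¬' (pv (χ x) ts)
  trans ρ χ (A ⇒ B)    = trans ρ χ A ⇒ trans ρ χ B
  trans ρ χ (∀₁ A)     = ∀₁ (trans ρ χ A)
  trans {Δ = Δ} {Θ} {Δ'} ρ χ (∀₂ k A) =
    ∀₂ k (trans (liftV ρ) (λ x → there {j = k} (χ x)) A)
  trans {Δ = Δ} {Θ} {Δ'} ρ χ (∀c k A) =
    ∀₂ k (trans (λ x → there {j = k} (ρ x)) (liftV χ) A)

  _* : ∀ {L n Δ Θ} → Formula S L n Δ Θ → Formula S AF n (Θ ++ Δ) []
  _* {Δ = Δ} {Θ = Θ} = trans (inr {Θ} {Δ}) (inl {Θ} {Δ})

module Submission where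

-- The translation trans ρ χ is taken relative to renamings ρ (ordinary
-- variables) and χ (starred copies X* of the classical X_C); A* is the case
-- ρ = inr, χ = inl.  By induction on LM2-derivations we translate Γ ⊢ A into
-- trans ρ χ Γ ⊢ trans ρ χ A for ALL ρ, χ, as the quantifier rules demand.
-- LAF2 rules go through because the translation commutes with weakening and
-- with term and predicate substitution (modules Substitution, Translation).
-- The dne axiom becomes ¬¬¬X* → ¬X*.  Classical ∀-elimination at a classical
-- type B yields A*[¬B*/X*] instead of (A[B/X_C])*: they differ by ¬¬B* versus
-- B*.  As B* ends with ⊥ it is ¬¬-stable in LAF2, so the relation _≅_ that
-- erases such double negations implies provable equivalence (modules
-- DoubleNegation, Deduction).

open import Defs
open import Data.List using (List; map; []; _∷_)
open import Data.List.Properties using (map-cong; map-∘)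
open import Data.List.Membership.Propositional.Properties using (∈-map⁺)
import Data.List.Relation.Unary.Any as Any
open import Data.Nat using (ℕ; zero; suc; _+_)
open import Data.Fin using (Fin; zero; suc; _↑ˡ_; _↑ʳ_; splitAt)
open import Data.Fin.Properties using (splitAt-↑ˡ)
open import Data.Vec using (Vec; []; _∷_; tabulate; lookup)
open import Data.Vec.Properties using (tabulate∘lookup; tabulate-cong)
open import Data.Sum using ([_,_]′)
open import Data.Product using (_×_; _,_; proj₁)
open import Relation.Binary.PropositionalEquality
  using (_≡_; refl; sym; cong; cong₂; subst; module ≡-Reasoning)
  renaming (trans to ≡-trans)

_⇛_ : List ℕ → List ℕ → Set
Δ ⇛ Δ' = ∀ {k} → Var Δ k → Var Δ' k

map-square : ∀ {A B C D : Set} {f : B → D} {g : A → B} {h : C → D} {k : A → C} →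
             (∀ x → f (g x) ≡ h (k x)) → ∀ xs → map f (map g xs) ≡ map h (map k xs)
map-square eq xs = ≡-trans (sym (map-∘ xs)) (≡-trans (map-cong eq xs) (map-∘ xs))

module Substitution {S : Signature} where

  mutual
    substT-ext : ∀ {n m} {σ σ' : Fin n → Term S m} → (∀ i → σ i ≡ σ' i) →
                 ∀ t → substT σ t ≡ substT σ' t
    substT-ext p (var i) = p i
    substT-ext p (app f ts) = cong (app f) (substTs-ext p ts)

    substTs-ext : ∀ {n m k} {σ σ' : Fin n → Term S m} → (∀ i → σ i ≡ σ' i) →
                  (ts : Vec (Term S n) k) → substTs σ ts ≡ substTs σ' ts
    substTs-ext p [] = refl
    substTs-ext p (t ∷ ts) = cong₂ _∷_ (substT-ext p t) (substTs-ext p ts)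

  mutual
    substT-comp : ∀ {n m l} (σ : Fin m → Term S l) (τ : Fin n → Term S m) t →
                  substT σ (substT τ t) ≡ substT (λ i → substT σ (τ i)) t
    substT-comp σ τ (var i) = refl
    substT-comp σ τ (app f ts) = cong (app f) (substTs-comp σ τ ts)

    substTs-comp : ∀ {n m l k} (σ : Fin m → Term S l) (τ : Fin n → Term S m)
                   (ts : Vec (Term S n) k) →
                   substTs σ (substTs τ ts) ≡ substTs (λ i → substT σ (τ i)) ts
    substTs-comp σ τ [] = refl
    substTs-comp σ τ (t ∷ ts) = cong₂ _∷_ (substT-comp σ τ t) (substTs-comp σ τ ts)

  mutual
    substT-id : ∀ {n} (t : Term S n) → substT var t ≡ t
    substT-id (var i) = refl
    substT-id (app f ts) = cong (app f) (substTs-id ts)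

    substTs-id : ∀ {n k} (ts : Vec (Term S n) k) → substTs var ts ≡ ts
    substTs-id [] = refl
    substTs-id (t ∷ ts) = cong₂ _∷_ (substT-id t) (substTs-id ts)

  liftT-ext : ∀ {n m} {σ σ' : Fin n → Term S m} → (∀ i → σ i ≡ σ' i) →
              ∀ i → liftT σ i ≡ liftT σ' i
  liftT-ext p zero = refl
  liftT-ext p (suc i) = cong (renT suc) (p i)

  liftT-comp : ∀ {n m l} (σ : Fin m → Term S l) (τ : Fin n → Term S m) →
               ∀ i → substT (liftT σ) (liftT τ i) ≡ liftT (λ j → substT σ (τ j)) i
  liftT-comp σ τ zero = refl
  liftT-comp σ τ (suc i) =
    ≡-trans (substT-comp (liftT σ) (λ j → var (suc j)) (τ i))
            (sym (substT-comp (λ j → var (suc j)) σ (τ i)))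

  liftT-id : ∀ {n} (i : Fin (suc n)) → liftT {S = S} var i ≡ var i
  liftT-id zero = refl
  liftT-id (suc i) = refl

  substTs-tabulate : ∀ {N m} k (σ : Fin N → Term S m) (g : Fin k → Fin N) →
                     substTs σ (tabulate (λ i → var (g i))) ≡ tabulate (λ i → σ (g i))
  substTs-tabulate zero σ g = refl
  substTs-tabulate (suc k) σ g = cong (σ (g zero) ∷_) (substTs-tabulate k σ (λ i → g (suc i)))

  apply-bvars : ∀ {n k} (ts : Vec (Term S n) k) →
                substTs (λ i → [ lookup ts , var ]′ (splitAt k i)) (bvars k n) ≡ ts
  apply-bvars {n} {k} ts =
    ≡-trans (substTs-tabulate k _ (λ i → i ↑ˡ n))
      (≡-trans (tabulate-cong (λ i → cong [ lookup ts , var ]′ (splitAt-↑ˡ k i n)))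
               (tabulate∘lookup ts))

  wkAbs-bvars : ∀ {n} k →
    substTs {S = S} (λ i → [ (λ j → var (j ↑ˡ suc n)) , (λ j → var (k ↑ʳ suc j)) ]′ (splitAt k i))
            (bvars k n) ≡ bvars k (suc n)
  wkAbs-bvars {n} k =
    ≡-trans (substTs-tabulate k _ (λ i → i ↑ˡ n))
      (tabulate-cong (λ i → cong [ (λ j → var (j ↑ˡ suc n)) , (λ j → var (k ↑ʳ suc j)) ]′
                                  (splitAt-↑ˡ k i n)))

  substF-ext : ∀ {L n m Δ Θ} {σ σ' : Fin n → Term S m} → (∀ i → σ i ≡ σ' i) →
               (A : Formula S L n Δ Θ) → substF σ A ≡ substF σ' A
  substF-ext p ⊥' = refl
  substF-ext p (rel P ts) = cong (rel P) (substTs-ext p ts)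
  substF-ext p (pv x ts) = cong (pv x) (substTs-ext p ts)
  substF-ext p (cv x ts) = cong (cv x) (substTs-ext p ts)
  substF-ext p (A ⇒ B) = cong₂ _⇒_ (substF-ext p A) (substF-ext p B)
  substF-ext p (∀₁ A) = cong ∀₁ (substF-ext (liftT-ext p) A)
  substF-ext p (∀₂ k A) = cong (∀₂ k) (substF-ext p A)
  substF-ext p (∀c k A) = cong (∀c k) (substF-ext p A)

  substF-comp : ∀ {L n m l Δ Θ} (σ : Fin m → Term S l) (τ : Fin n → Term S m)
                (A : Formula S L n Δ Θ) →
                substF σ (substF τ A) ≡ substF (λ i → substT σ (τ i)) A
  substF-comp σ τ ⊥' = refl
  substF-comp σ τ (rel P ts) = cong (rel P) (substTs-comp σ τ ts)
  substF-comp σ τ (pv x ts) = cong (pv x) (substTs-comp σ τ ts)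
  substF-comp σ τ (cv x ts) = cong (cv x) (substTs-comp σ τ ts)
  substF-comp σ τ (A ⇒ B) = cong₂ _⇒_ (substF-comp σ τ A) (substF-comp σ τ B)
  substF-comp σ τ (∀₁ A) =
    cong ∀₁ (≡-trans (substF-comp (liftT σ) (liftT τ) A) (substF-ext (liftT-comp σ τ) A))
  substF-comp σ τ (∀₂ k A) = cong (∀₂ k) (substF-comp σ τ A)
  substF-comp σ τ (∀c k A) = cong (∀c k) (substF-comp σ τ A)

  substF-id : ∀ {L n Δ Θ} (A : Formula S L n Δ Θ) → substF var A ≡ A
  substF-id ⊥' = refl
  substF-id (rel P ts) = cong (rel P) (substTs-id ts)
  substF-id (pv x ts) = cong (pv x) (substTs-id ts)
  substF-id (cv x ts) = cong (cv x) (substTs-id ts)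
  substF-id (A ⇒ B) = cong₂ _⇒_ (substF-id A) (substF-id B)
  substF-id (∀₁ A) = cong ∀₁ (≡-trans (substF-ext liftT-id A) (substF-id A))
  substF-id (∀₂ k A) = cong (∀₂ k) (substF-id A)
  substF-id (∀c k A) = cong (∀c k) (substF-id A)

  inst₁-fresh : ∀ {L n Δ Θ} (F : Formula S L (suc n) Δ Θ) →
                inst₁ (substF (liftT (λ i → var (suc i))) F) (var zero) ≡ F
  inst₁-fresh F = begin
    inst₁ (substF (liftT (λ i → var (suc i))) F) (var zero)
      ≡⟨ substF-comp _ _ F ⟩
    substF _ F
      ≡⟨ substF-ext (λ { zero → refl ; (suc i) → refl }) F ⟩
    substF var F
      ≡⟨ substF-id F ⟩
    F ∎
    where open ≡-Reasoning

  liftV-ext : ∀ {Δ Δ' j} {ρ ρ' : Δ ⇛ Δ'} → (∀ {k} (x : Var Δ k) → ρ x ≡ ρ' x) →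
              ∀ {k} (x : Var (j ∷ Δ) k) → liftV ρ x ≡ liftV ρ' x
  liftV-ext p here = refl
  liftV-ext p (there x) = cong there (p x)

  liftV-comp : ∀ {Δ Δ₁ Δ₂ j} (ρ : Δ₁ ⇛ Δ₂) (π : Δ ⇛ Δ₁) →
               ∀ {k} (x : Var (j ∷ Δ) k) → liftV ρ (liftV π x) ≡ liftV (λ y → ρ (π y)) x
  liftV-comp ρ π here = refl
  liftV-comp ρ π (there x) = refl

  substP-ext : ∀ {L n Δ Δ' Θ} {σ σ' : ∀ {k} → Var Δ k → Formula S L (k + n) Δ' Θ} →
               (∀ {k} (x : Var Δ k) → σ x ≡ σ' x) →
               (A : Formula S L n Δ Θ) → substP σ A ≡ substP σ' A
  substP-ext p ⊥' = refl
  substP-ext p (rel P ts) = refl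
  substP-ext p (pv x ts) = cong (λ B → apply B ts) (p x)
  substP-ext p (cv x ts) = refl
  substP-ext p (A ⇒ B) = cong₂ _⇒_ (substP-ext p A) (substP-ext p B)
  substP-ext p (∀₁ A) = cong ∀₁ (substP-ext (λ x → cong wkAbs (p x)) A)
  substP-ext p (∀₂ j A) =
    cong (∀₂ j) (substP-ext (λ { here → refl ; (there x) → cong (renP there) (p x) }) A)
  substP-ext p (∀c j A) = cong (∀c j) (substP-ext (λ x → cong (renC there) (p x)) A)

  liftP : ∀ {L n Δ Δ' Θ j} → (∀ {k} → Var Δ k → Formula S L (k + n) Δ' Θ) →
          ∀ {k} → Var (j ∷ Δ) k → Formula S L (k + n) (j ∷ Δ') Θ
  liftP {n = n} {j = j} σ here = pv here (bvars j n)
  liftP σ (there x) = renP there (σ x)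

  substP-∀₂ : ∀ {L n Δ Δ' Θ j} (σ : ∀ {k} → Var Δ k → Formula S L (k + n) Δ' Θ)
              (A : Formula S L n (j ∷ Δ) Θ) → substP σ (∀₂ j A) ≡ ∀₂ j (substP (liftP σ) A)
  substP-∀₂ σ A = cong (∀₂ _) (substP-ext (λ { here → refl ; (there x) → refl }) A)

  substP-renP : ∀ {L n Δ Δ₁ Δ' Θ} (σ : ∀ {k} → Var Δ₁ k → Formula S L (k + n) Δ' Θ)
                (π : Δ ⇛ Δ₁) (A : Formula S L n Δ Θ) →
                substP σ (renP π A) ≡ substP (λ x → σ (π x)) A
  substP-renP σ π ⊥' = refl
  substP-renP σ π (rel P ts) = refl
  substP-renP σ π (pv x ts) = refl
  substP-renP σ π (cv x ts) = refl
  substP-renP σ π (A ⇒ B) = cong₂ _⇒_ (substP-renP σ π A) (substP-renP σ π B)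
  substP-renP σ π (∀₁ A) = cong ∀₁ (substP-renP _ π A)
  substP-renP σ π (∀₂ j A) =
    ≡-trans (substP-∀₂ σ (renP (liftV π) A))
      (≡-trans (cong (∀₂ j) (≡-trans (substP-renP (liftP σ) (liftV π) A)
                 (substP-ext (λ { here → refl ; (there x) → refl }) A)))
               (sym (substP-∀₂ (λ x → σ (π x)) A)))
  substP-renP σ π (∀c j A) = cong (∀c j) (substP-renP _ π A)

  substP-id : ∀ {L n Δ Θ} (A : Formula S L n Δ Θ) →
              substP (λ {k} x → pv x (bvars k n)) A ≡ A
  substP-id ⊥' = refl
  substP-id (rel P ts) = refl
  substP-id (pv x ts) = cong (pv x) (apply-bvars ts)
  substP-id (cv x ts) = refl
  substP-id (A ⇒ B) = cong₂ _⇒_ (substP-id A) (substP-id B)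
  substP-id (∀₁ A) =
    cong ∀₁ (≡-trans (substP-ext (λ {k} x → cong (pv x) (wkAbs-bvars k)) A) (substP-id A))
  substP-id (∀₂ j A) =
    ≡-trans (substP-∀₂ _ A)
      (cong (∀₂ j) (≡-trans (substP-ext (λ { here → refl ; (there x) → refl }) A) (substP-id A)))
  substP-id (∀c j A) = cong (∀c j) (substP-id A)

  inst₂-fresh : ∀ {L n Δ Θ k} (F : Formula S L n (k ∷ Δ) Θ) →
                inst₂ (renP (liftV there) F) (pv here (bvars k n)) ≡ F
  inst₂-fresh F = begin
    inst₂ (renP (liftV there) F) (pv here (bvars _ _))
      ≡⟨ substP-renP _ (liftV there) F ⟩
    substP _ F
      ≡⟨ substP-ext (λ { here → refl ; (there x) → refl }) F ⟩
    substP (λ {k} x → pv x (bvars k _)) F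
      ≡⟨ substP-id F ⟩
    F ∎
    where open ≡-Reasoning

  substC-ext : ∀ {n Δ Θ Θ'} {σ σ' : ∀ {k} → Var Θ k → Formula S M (k + n) Δ Θ'} →
               (∀ {k} (x : Var Θ k) → σ x ≡ σ' x) →
               (A : Formula S M n Δ Θ) → substC σ A ≡ substC σ' A
  substC-ext p ⊥' = refl
  substC-ext p (rel P ts) = refl
  substC-ext p (pv x ts) = refl
  substC-ext p (cv x ts) = cong (λ B → apply B ts) (p x)
  substC-ext p (A ⇒ B) = cong₂ _⇒_ (substC-ext p A) (substC-ext p B)
  substC-ext p (∀₁ A) = cong ∀₁ (substC-ext (λ x → cong wkAbs (p x)) A)
  substC-ext p (∀₂ j A) = cong (∀₂ j) (substC-ext (λ x → cong (renP there) (p x)) A)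
  substC-ext p (∀c j A) =
    cong (∀c j) (substC-ext (λ { here → refl ; (there x) → cong (renC there) (p x) }) A)

  liftC : ∀ {n Δ Θ Θ' j} → (∀ {k} → Var Θ k → Formula S M (k + n) Δ Θ') →
          ∀ {k} → Var (j ∷ Θ) k → Formula S M (k + n) Δ (j ∷ Θ')
  liftC {n = n} {j = j} σ here = cv here (bvars j n)
  liftC σ (there x) = renC there (σ x)

  substC-∀c : ∀ {n Δ Θ Θ' j} (σ : ∀ {k} → Var Θ k → Formula S M (k + n) Δ Θ')
              (A : Formula S M n Δ (j ∷ Θ)) → substC σ (∀c j A) ≡ ∀c j (substC (liftC σ) A)
  substC-∀c σ A = cong (∀c _) (substC-ext (λ { here → refl ; (there x) → refl }) A)

module Translation {S : Signature} where
  open Substitution {S}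

  trans-ext : ∀ {L n Δ Θ Δ'} {ρ ρ' : Δ ⇛ Δ'} {χ χ' : Θ ⇛ Δ'} →
              (∀ {k} (x : Var Δ k) → ρ x ≡ ρ' x) → (∀ {k} (x : Var Θ k) → χ x ≡ χ' x) →
              (A : Formula S L n Δ Θ) → trans ρ χ A ≡ trans ρ' χ' A
  trans-ext p q ⊥' = refl
  trans-ext p q (rel P ts) = refl
  trans-ext p q (pv x ts) = cong (λ y → pv y ts) (p x)
  trans-ext p q (cv x ts) = cong (λ y → ¬' (pv y ts)) (q x)
  trans-ext p q (A ⇒ B) = cong₂ _⇒_ (trans-ext p q A) (trans-ext p q B)
  trans-ext p q (∀₁ A) = cong ∀₁ (trans-ext p q A)
  trans-ext p q (∀₂ k A) = cong (∀₂ k) (trans-ext (liftV-ext p) (λ x → cong there (q x)) A)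
  trans-ext p q (∀c k A) = cong (∀₂ k) (trans-ext (λ x → cong there (p x)) (liftV-ext q) A)

  trans-substF : ∀ {L n m Δ Θ Δ'} {ρ : Δ ⇛ Δ'} {χ : Θ ⇛ Δ'} {σ : Fin n → Term S m}
                 (A : Formula S L n Δ Θ) → trans ρ χ (substF σ A) ≡ substF σ (trans ρ χ A)
  trans-substF ⊥' = refl
  trans-substF (rel P ts) = refl
  trans-substF (pv x ts) = refl
  trans-substF (cv x ts) = refl
  trans-substF (A ⇒ B) = cong₂ _⇒_ (trans-substF A) (trans-substF B)
  trans-substF (∀₁ A) = cong ∀₁ (trans-substF A)
  trans-substF (∀₂ k A) = cong (∀₂ k) (trans-substF A)
  trans-substF (∀c k A) = cong (∀₂ k) (trans-substF A)

  trans-renP : ∀ {L n Δ Δ₁ Θ Δ'} {ρ : Δ₁ ⇛ Δ'} {χ : Θ ⇛ Δ'} (π : Δ ⇛ Δ₁)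
               (A : Formula S L n Δ Θ) → trans ρ χ (renP π A) ≡ trans (λ x → ρ (π x)) χ A
  trans-renP π ⊥' = refl
  trans-renP π (rel P ts) = refl
  trans-renP π (pv x ts) = refl
  trans-renP π (cv x ts) = refl
  trans-renP π (A ⇒ B) = cong₂ _⇒_ (trans-renP π A) (trans-renP π B)
  trans-renP π (∀₁ A) = cong ∀₁ (trans-renP π A)
  trans-renP {ρ = ρ} π (∀₂ k A) =
    cong (∀₂ k) (≡-trans (trans-renP (liftV π) A) (trans-ext (liftV-comp ρ π) (λ x → refl) A))
  trans-renP π (∀c k A) = cong (∀₂ k) (trans-renP π A)

  trans-renC : ∀ {n Δ Θ Θ₁ Δ'} {ρ : Δ ⇛ Δ'} {χ : Θ₁ ⇛ Δ'} (π : Θ ⇛ Θ₁)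
               (A : Formula S M n Δ Θ) → trans ρ χ (renC π A) ≡ trans ρ (λ x → χ (π x)) A
  trans-renC π ⊥' = refl
  trans-renC π (rel P ts) = refl
  trans-renC π (pv x ts) = refl
  trans-renC π (cv x ts) = refl
  trans-renC π (A ⇒ B) = cong₂ _⇒_ (trans-renC π A) (trans-renC π B)
  trans-renC π (∀₁ A) = cong ∀₁ (trans-renC π A)
  trans-renC π (∀₂ k A) = cong (∀₂ k) (trans-renC π A)
  trans-renC {χ = χ} π (∀c k A) =
    cong (∀₂ k) (≡-trans (trans-renC (liftV π) A) (trans-ext (λ x → refl) (liftV-comp χ π) A))

  renP-trans : ∀ {L n Δ Θ Δ' Δ''} {ρ : Δ ⇛ Δ'} {χ : Θ ⇛ Δ'} (π : Δ' ⇛ Δ'')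
               (A : Formula S L n Δ Θ) →
               renP π (trans ρ χ A) ≡ trans (λ x → π (ρ x)) (λ x → π (χ x)) A
  renP-trans π ⊥' = refl
  renP-trans π (rel P ts) = refl
  renP-trans π (pv x ts) = refl
  renP-trans π (cv x ts) = refl
  renP-trans π (A ⇒ B) = cong₂ _⇒_ (renP-trans π A) (renP-trans π B)
  renP-trans π (∀₁ A) = cong ∀₁ (renP-trans π A)
  renP-trans {ρ = ρ} π (∀₂ k A) =
    cong (∀₂ k) (≡-trans (renP-trans (liftV π) A) (trans-ext (liftV-comp π ρ) (λ x → refl) A))
  renP-trans {χ = χ} π (∀c k A) =
    cong (∀₂ k) (≡-trans (renP-trans (liftV π) A) (trans-ext (λ x → refl) (liftV-comp π χ) A))

  trans-wk₂ : ∀ {L n Δ Θ Δ' k} {ρ : Δ ⇛ Δ'} {χ : Θ ⇛ Δ'} (A : Formula S L n Δ Θ) →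
              trans (liftV {j = k} ρ) (λ x → there (χ x)) (wk₂ A) ≡ wk₂ (trans ρ χ A)
  trans-wk₂ A = ≡-trans (trans-renP there A) (sym (renP-trans there A))

  trans-wkC : ∀ {n Δ Θ Δ' k} {ρ : Δ ⇛ Δ'} {χ : Θ ⇛ Δ'} (A : Formula S M n Δ Θ) →
              trans (λ x → there {j = k} (ρ x)) (liftV χ) (wkC A) ≡ wk₂ (trans ρ χ A)
  trans-wkC A = ≡-trans (trans-renC there A) (sym (renP-trans there A))

  trans-∀ⁿ : ∀ {L n Δ Θ Δ'} {ρ : Δ ⇛ Δ'} {χ : Θ ⇛ Δ'} k (A : Formula S L (k + n) Δ Θ) →
             trans ρ χ (∀ⁿ k A) ≡ ∀ⁿ k (trans ρ χ A)
  trans-∀ⁿ zero A = refl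
  trans-∀ⁿ (suc k) A = trans-∀ⁿ k (∀₁ A)

  trans-substP : ∀ {n Δ Θ Δ₁ Δ' Δ₀} (A : Formula S M n Δ Θ)
                 {σ : ∀ {k} → Var Δ k → Formula S M (k + n) Δ₁ Θ}
                 {ρ : Δ₁ ⇛ Δ'} {χ : Θ ⇛ Δ'} {ρ₀ : Δ ⇛ Δ₀} {χ₀ : Θ ⇛ Δ₀}
                 {τ : ∀ {k} → Var Δ₀ k → Formula S AF (k + n) Δ' []} →
                 (∀ {k} (x : Var Δ k) → τ (ρ₀ x) ≡ trans ρ χ (σ x)) →
                 (∀ {k} (x : Var Θ k) → τ (χ₀ x) ≡ pv (χ x) (bvars k n)) →
                 trans ρ χ (substP σ A) ≡ substP τ (trans ρ₀ χ₀ A)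
  trans-substP ⊥' a b = refl
  trans-substP (rel P ts) a b = refl
  trans-substP (pv x ts) {σ} a b =
    ≡-trans (trans-substF (σ x)) (cong (λ B → apply B ts) (sym (a x)))
  trans-substP (cv x ts) {χ = χ} a b =
    cong ¬' (sym (≡-trans (cong (λ B → apply B ts) (b x)) (cong (pv (χ x)) (apply-bvars ts))))
  trans-substP (A ⇒ B) a b = cong₂ _⇒_ (trans-substP A a b) (trans-substP B a b)
  trans-substP (∀₁ A) {σ} {χ = χ} a b =
    cong ∀₁ (trans-substP A (λ x → ≡-trans (cong wkAbs (a x)) (sym (trans-substF (σ x))))
                  (λ {k} x → ≡-trans (cong wkAbs (b x)) (cong (pv (χ x)) (wkAbs-bvars k))))
  trans-substP (∀₂ j A) {σ} {ρ} {χ} {ρ₀} {χ₀} {τ} a b =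
    ≡-trans (cong (trans ρ χ) (substP-∀₂ σ A))
      (≡-trans (cong (∀₂ j) (trans-substP A {σ = liftP σ} {ρ = liftV ρ} {χ = λ x → there (χ x)}
                              {ρ₀ = liftV ρ₀} {χ₀ = λ x → there (χ₀ x)} {τ = liftP τ}
                 (λ { here → refl
                    ; (there x) → ≡-trans (cong (renP there) (a x))
                                    (≡-trans (renP-trans there (σ x)) (sym (trans-renP there (σ x)))) })
                 (λ x → cong (renP there) (b x))))
               (sym (substP-∀₂ τ (trans (liftV ρ₀) (λ x → there (χ₀ x)) A))))
  trans-substP (∀c j A) {σ} {ρ} {χ} {ρ₀} {χ₀} {τ} a b =
    ≡-trans (cong (trans ρ χ) (cong (∀c j) (substP-ext (λ x → refl) A)))
      (≡-trans (cong (∀₂ j) (trans-substP A {σ = λ x → renC there (σ x)} {ρ = λ x → there (ρ x)}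
                              {χ = liftV χ} {ρ₀ = λ x → there (ρ₀ x)} {χ₀ = liftV χ₀} {τ = liftP τ}
                 (λ x → ≡-trans (cong (renP there) (a x))
                          (≡-trans (renP-trans there (σ x)) (sym (trans-renC there (σ x)))))
                 (λ { here → refl ; (there x) → cong (renP there) (b x) })))
               (sym (substP-∀₂ τ (trans (λ x → there (ρ₀ x)) (liftV χ₀) A))))

  trans-inst₂ : ∀ {n Δ Θ Δ' k} {ρ : Δ ⇛ Δ'} {χ : Θ ⇛ Δ'}
                (A : Formula S M n (k ∷ Δ) Θ) (B : Formula S M (k + n) Δ Θ) →
                trans ρ χ (inst₂ A B) ≡ inst₂ (trans (liftV ρ) (λ x → there (χ x)) A) (trans ρ χ B)
  trans-inst₂ A B =
    trans-substP A (λ { here → refl ; (there x) → refl }) (λ x → refl)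

module DoubleNegation {S : Signature} where
  open Substitution {S}
  open Translation {S}

  data Negative : ∀ {n Δ} → Formula S AF n Δ [] → Set where
    n⊥  : ∀ {n Δ} → Negative {n} {Δ} ⊥'
    n⇒  : ∀ {n Δ} {A B : Formula S AF n Δ []} → Negative B → Negative (A ⇒ B)
    n∀₁ : ∀ {n Δ} {A : Formula S AF (suc n) Δ []} → Negative A → Negative (∀₁ A)
    n∀₂ : ∀ {n Δ k} {A : Formula S AF n (k ∷ Δ) []} → Negative A → Negative (∀₂ k A)

  infix 4 _≅_
  data _≅_ : ∀ {n Δ} → Formula S AF n Δ [] → Formula S AF n Δ [] → Set where
    ≅-refl : ∀ {n Δ} {A : Formula S AF n Δ []} → A ≅ A
    ≅-⇒    : ∀ {n Δ} {A A' B B' : Formula S AF n Δ []} → A ≅ A' → B ≅ B' → A ⇒ B ≅ A' ⇒ B'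
    ≅-∀₁   : ∀ {n Δ} {A A' : Formula S AF (suc n) Δ []} → A ≅ A' → ∀₁ A ≅ ∀₁ A'
    ≅-∀₂   : ∀ {n Δ k} {A A' : Formula S AF n (k ∷ Δ) []} → A ≅ A' → ∀₂ k A ≅ ∀₂ k A'
    ≅-¬¬   : ∀ {n Δ} {C : Formula S AF n Δ []} → Negative C → ¬' (¬' C) ≅ C

  Negative-substF : ∀ {n m Δ} {σ : Fin n → Term S m} {C : Formula S AF n Δ []} →
                    Negative C → Negative (substF σ C)
  Negative-substF n⊥ = n⊥
  Negative-substF (n⇒ c) = n⇒ (Negative-substF c)
  Negative-substF (n∀₁ c) = n∀₁ (Negative-substF c)
  Negative-substF (n∀₂ c) = n∀₂ (Negative-substF c)

  Negative-renP : ∀ {n Δ Δ'} {π : Δ ⇛ Δ'} {C : Formula S AF n Δ []} →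
                  Negative C → Negative (renP π C)
  Negative-renP n⊥ = n⊥
  Negative-renP (n⇒ c) = n⇒ (Negative-renP c)
  Negative-renP (n∀₁ c) = n∀₁ (Negative-renP c)
  Negative-renP (n∀₂ c) = n∀₂ (Negative-renP c)

  ≅-substF : ∀ {n m Δ} {σ : Fin n → Term S m} {A B : Formula S AF n Δ []} →
             A ≅ B → substF σ A ≅ substF σ B
  ≅-substF ≅-refl = ≅-refl
  ≅-substF (≅-⇒ r s) = ≅-⇒ (≅-substF r) (≅-substF s)
  ≅-substF (≅-∀₁ r) = ≅-∀₁ (≅-substF r)
  ≅-substF (≅-∀₂ r) = ≅-∀₂ (≅-substF r)
  ≅-substF (≅-¬¬ c) = ≅-¬¬ (Negative-substF c)

  ≅-renP : ∀ {n Δ Δ'} {π : Δ ⇛ Δ'} {A B : Formula S AF n Δ []} →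
           A ≅ B → renP π A ≅ renP π B
  ≅-renP ≅-refl = ≅-refl
  ≅-renP (≅-⇒ r s) = ≅-⇒ (≅-renP r) (≅-renP s)
  ≅-renP (≅-∀₁ r) = ≅-∀₁ (≅-renP r)
  ≅-renP (≅-∀₂ r) = ≅-∀₂ (≅-renP r)
  ≅-renP (≅-¬¬ c) = ≅-¬¬ (Negative-renP c)

  Negative-trans : ∀ {n Δ Θ Δ'} {ρ : Δ ⇛ Δ'} {χ : Θ ⇛ Δ'} {B : Formula S M n Δ Θ} →
                   ClassicalType B → Negative (trans ρ χ B)
  Negative-trans ct⊥ = n⊥
  Negative-trans (ctcv x ts) = n⇒ n⊥
  Negative-trans (ct⇒ c) = n⇒ (Negative-trans c)
  Negative-trans (ct∀₁ c) = n∀₁ (Negative-trans c)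
  Negative-trans (ct∀₂ c) = n∀₂ (Negative-trans c)
  Negative-trans (ct∀c c) = n∀₂ (Negative-trans c)

  trans-substC : ∀ {n Δ Θ Θ₁ Δ' Δ₀} (A : Formula S M n Δ Θ)
                 {σ : ∀ {k} → Var Θ k → Formula S M (k + n) Δ Θ₁}
                 {ρ : Δ ⇛ Δ'} {χ : Θ₁ ⇛ Δ'} {ρ₀ : Δ ⇛ Δ₀} {χ₀ : Θ ⇛ Δ₀}
                 {τ : ∀ {k} → Var Δ₀ k → Formula S AF (k + n) Δ' []} →
                 (∀ {k} (x : Var Δ k) → τ (ρ₀ x) ≡ pv (ρ x) (bvars k n)) →
                 (∀ {k} (x : Var Θ k) → ¬' (τ (χ₀ x)) ≅ trans ρ χ (σ x)) →
                 substP τ (trans ρ₀ χ₀ A) ≅ trans ρ χ (substC σ A)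
  trans-substC ⊥' a b = ≅-refl
  trans-substC (rel P ts) a b = ≅-refl
  trans-substC (pv x ts) {ρ = ρ} a b =
    subst (λ F → F ≅ pv (ρ x) ts)
      (sym (≡-trans (cong (λ B → apply B ts) (a x)) (cong (pv (ρ x)) (apply-bvars ts)))) ≅-refl
  trans-substC (cv x ts) {σ} a b = subst (_ ≅_) (sym (trans-substF (σ x))) (≅-substF (b x))
  trans-substC (A ⇒ B) a b = ≅-⇒ (trans-substC A a b) (trans-substC B a b)
  trans-substC (∀₁ A) {σ} {ρ = ρ} a b =
    ≅-∀₁ (trans-substC A (λ {k} x → ≡-trans (cong wkAbs (a x)) (cong (pv (ρ x)) (wkAbs-bvars k)))
                         (λ x → subst (_ ≅_) (sym (trans-substF (σ x))) (≅-substF (b x))))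
  trans-substC (∀₂ j A) {σ} {ρ} {χ} {ρ₀} {χ₀} {τ} a b =
    subst (λ F → F ≅ trans ρ χ (substC σ (∀₂ j A)))
      (sym (substP-∀₂ τ (trans (liftV ρ₀) (λ x → there (χ₀ x)) A)))
      (≅-∀₂ (trans-substC A {σ = λ x → renP there (σ x)} {ρ = liftV ρ} {χ = λ x → there (χ x)}
                            {ρ₀ = liftV ρ₀} {χ₀ = λ x → there (χ₀ x)} {τ = liftP τ}
               (λ { here → refl ; (there x) → cong (renP there) (a x) })
               (λ x → subst (_ ≅_) (≡-trans (renP-trans there (σ x)) (sym (trans-renP there (σ x))))
                          (≅-renP (b x)))))
  trans-substC (∀c j A) {σ} {ρ} {χ} {ρ₀} {χ₀} {τ} a b =
    subst (λ F → F ≅ trans ρ χ (substC σ (∀c j A)))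
      (sym (substP-∀₂ τ (trans (λ x → there (ρ₀ x)) (liftV χ₀) A)))
      (subst (∀₂ j (substP (liftP τ) (trans (λ x → there (ρ₀ x)) (liftV χ₀) A)) ≅_)
             (sym (cong (trans ρ χ) (substC-∀c σ A)))
        (≅-∀₂ (trans-substC A {σ = liftC σ} {ρ = λ x → there (ρ x)} {χ = liftV χ}
                              {ρ₀ = λ x → there (ρ₀ x)} {χ₀ = liftV χ₀} {τ = liftP τ}
                 (λ x → cong (renP there) (a x))
                 (λ { here → ≅-refl
                    ; (there x) → subst (_ ≅_)
                                    (≡-trans (renP-trans there (σ x)) (sym (trans-renC there (σ x))))
                                    (≅-renP (b x)) }))))

  -- Rule ∀cE: instantiating X* by ¬B* in A's translation gives, up to ≅,
  -- the translation of A[B/X_C], because B* is negative.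
  trans-instC : ∀ {n Δ Θ Δ' k} {ρ : Δ ⇛ Δ'} {χ : Θ ⇛ Δ'}
                (A : Formula S M n Δ (k ∷ Θ)) (B : Formula S M (k + n) Δ Θ) → ClassicalType B →
                inst₂ (trans (λ x → there (ρ x)) (liftV χ) A) (¬' (trans ρ χ B))
                  ≅ trans ρ χ (instC A B)
  trans-instC {n = n} {ρ = ρ} {χ} A B cB =
    subst (_≅ trans ρ χ (instC A B))
      (substP-ext (λ { here → refl ; (there x) → refl }) (trans (λ x → there (ρ x)) (liftV χ) A))
      (trans-substC A {ρ₀ = λ x → there (ρ x)} {χ₀ = liftV χ} {τ = τ}
         (λ x → refl) (λ { here → ≅-¬¬ (Negative-trans cB) ; (there x) → ≅-refl }))
    where
      τ : ∀ {j} → Var (_ ∷ _) j → Formula S AF (j + n) _ []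
      τ here = ¬' (trans ρ χ B)
      τ {j} (there y) = pv y (bvars j n)

module Deduction {S : Signature} (E : EqTheory S) where
  open Substitution {S}
  open DoubleNegation {S}

  hyp₀ : ∀ {L n Δ Θ} {Γ : List (Formula S L n Δ Θ)} {A} → Derivation E (A ∷ Γ) A
  hyp₀ = hyp (Any.here refl)

  hyp₁ : ∀ {L n Δ Θ} {Γ : List (Formula S L n Δ Θ)} {A B} → Derivation E (B ∷ A ∷ Γ) A
  hyp₁ = hyp (Any.there (Any.here refl))

  hyp₂ : ∀ {L n Δ Θ} {Γ : List (Formula S L n Δ Θ)} {A B C} → Derivation E (C ∷ B ∷ A ∷ Γ) A
  hyp₂ = hyp (Any.there (Any.there (Any.here refl)))

  ∀₁E-fresh : ∀ {L n Δ Θ} {Γ : List (Formula S L (suc n) Δ Θ)} {F : Formula S L (suc n) Δ Θ} →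
              Derivation E Γ (wk₁ (∀₁ F)) → Derivation E Γ F
  ∀₁E-fresh {F = F} d = subst (Derivation E _) (inst₁-fresh F) (∀₁E d (var zero))

  ∀₂E-fresh : ∀ {L n Δ Θ k} {Γ : List (Formula S L n (k ∷ Δ) Θ)} {F : Formula S L n (k ∷ Δ) Θ} →
              Derivation E Γ (wk₂ (∀₂ k F)) → Derivation E Γ F
  ∀₂E-fresh {n = n} {k = k} {F = F} d =
    subst (Derivation E _) (inst₂-fresh F) (∀₂E d (pv here (bvars k n)))

  Valid : ∀ {n Δ} → Formula S AF n Δ [] → Set
  Valid {n} {Δ} F = (Γ : List (Formula S AF n Δ [])) → Derivation E Γ F

  Stable : ∀ {n Δ} → Formula S AF n Δ [] → Set
  Stable F = Valid (¬' (¬' F) ⇒ F)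

  _⟷_ : ∀ {n Δ} → Formula S AF n Δ [] → Formula S AF n Δ [] → Set
  F ⟷ G = Valid (F ⇒ G) × Valid (G ⇒ F)

  ⇒-mono : ∀ {n Δ} {A A' B B' : Formula S AF n Δ []} →
           Valid (A' ⇒ A) → Valid (B ⇒ B') → Valid ((A ⇒ B) ⇒ (A' ⇒ B'))
  ⇒-mono a b Γ = ⇒I (⇒I (⇒E (b _) (⇒E hyp₁ (⇒E (a _) hyp₀))))

  ∀₁-mono : ∀ {n Δ} {F G : Formula S AF (suc n) Δ []} → Valid (F ⇒ G) → Valid (∀₁ F ⇒ ∀₁ G)
  ∀₁-mono f Γ = ⇒I (∀₁I (⇒E (f _) (∀₁E-fresh hyp₀)))

  ∀₂-mono : ∀ {n Δ k} {F G : Formula S AF n (k ∷ Δ) []} → Valid (F ⇒ G) → Valid (∀₂ k F ⇒ ∀₂ k G)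
  ∀₂-mono f Γ = ⇒I (∀₂I (⇒E (f _) (∀₂E-fresh hyp₀)))

  stable-⊥ : ∀ {n Δ} → Stable {n} {Δ} ⊥'
  stable-⊥ Γ = ⇒I (⇒E hyp₀ (⇒I hyp₀))

  stable-⇒ : ∀ {n Δ} {A B : Formula S AF n Δ []} → Stable B → Stable (A ⇒ B)
  stable-⇒ s Γ = ⇒I (⇒I (⇒E (s _) (⇒I (⇒E hyp₂ (⇒I (⇒E hyp₁ (⇒E hyp₀ hyp₂)))))))

  stable-∀₁ : ∀ {n Δ} {F : Formula S AF (suc n) Δ []} → Stable F → Stable (∀₁ F)
  stable-∀₁ s Γ = ⇒I (∀₁I (⇒E (s _) (⇒I (⇒E hyp₁ (⇒I (⇒E hyp₁ (∀₁E-fresh hyp₀)))))))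

  stable-∀₂ : ∀ {n Δ k} {F : Formula S AF n (k ∷ Δ) []} → Stable F → Stable (∀₂ k F)
  stable-∀₂ s Γ = ⇒I (∀₂I (⇒E (s _) (⇒I (⇒E hyp₁ (⇒I (⇒E hyp₁ (∀₂E-fresh hyp₀)))))))

  negative-stable : ∀ {n Δ} {C : Formula S AF n Δ []} → Negative C → Stable C
  negative-stable n⊥ = stable-⊥
  negative-stable (n⇒ c) = stable-⇒ (negative-stable c)
  negative-stable (n∀₁ c) = stable-∀₁ (negative-stable c)
  negative-stable (n∀₂ c) = stable-∀₂ (negative-stable c)

  ≅-equivalent : ∀ {n Δ} {F G : Formula S AF n Δ []} → F ≅ G → F ⟷ G
  ≅-equivalent ≅-refl = (λ Γ → ⇒I hyp₀) , (λ Γ → ⇒I hyp₀)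
  ≅-equivalent (≅-⇒ r s) with ≅-equivalent r | ≅-equivalent s
  ... | a , a' | b , b' = ⇒-mono a' b , ⇒-mono a b'
  ≅-equivalent (≅-∀₁ r) with ≅-equivalent r
  ... | f , g = ∀₁-mono f , ∀₁-mono g
  ≅-equivalent (≅-∀₂ r) with ≅-equivalent r
  ... | f , g = ∀₂-mono f , ∀₂-mono g
  ≅-equivalent (≅-¬¬ c) = negative-stable c , (λ Γ → ⇒I (⇒I (⇒E hyp₀ hyp₁)))

  ∀ⁿ-valid : ∀ {n Δ} k {B : Formula S AF (k + n) Δ []} → Valid B → Valid (∀ⁿ k B)
  ∀ⁿ-valid zero h = h
  ∀ⁿ-valid (suc k) h = ∀ⁿ-valid k (λ Γ → ∀₁I (h _))

module Soundness {S : Signature} (E : EqTheory S) where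
  open Translation {S}
  open DoubleNegation {S}
  open Deduction E

  -- The translated dne axiom: its body ¬¬(¬X*) → ¬X* is stability of the negative ¬X*.
  dneAxiom-translation : ∀ {n Δ Θ Δ'} {ρ : Δ ⇛ Δ'} {χ : Θ ⇛ Δ'} k →
                         Valid (trans ρ χ (dneAxiom {n = n} {Δ} {Θ} k))
  dneAxiom-translation k Γ =
    ∀₂I (subst (Derivation E _) (sym (trans-∀ⁿ k _))
               (∀ⁿ-valid k (negative-stable (n⇒ n⊥)) _))

  translate : ∀ {n Δ Θ Δ'} (ρ : Δ ⇛ Δ') (χ : Θ ⇛ Δ') {Γ : List (Formula S M n Δ Θ)} {A} →
              Derivation E Γ A → Derivation E (map (trans ρ χ) Γ) (trans ρ χ A)
  translate ρ χ (hyp m) = hyp (∈-map⁺ (trans ρ χ) m)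
  translate ρ χ (⇒I d) = ⇒I (translate ρ χ d)
  translate ρ χ (⇒E d e) = ⇒E (translate ρ χ d) (translate ρ χ e)
  translate ρ χ (∀₁I {Γ = Γ} d) =
    ∀₁I (subst (λ Γ' → Derivation E Γ' _) (map-square trans-substF Γ) (translate ρ χ d))
  translate ρ χ (∀₁E {A = A} d t) =
    subst (Derivation E _) (sym (trans-substF A)) (∀₁E (translate ρ χ d) t)
  translate ρ χ (∀₂I {Γ = Γ} d) =
    ∀₂I (subst (λ Γ' → Derivation E Γ' _) (map-square trans-wk₂ Γ)
               (translate (liftV ρ) (λ x → there (χ x)) d))
  translate ρ χ (∀₂E {A = A} d B) =
    subst (Derivation E _) (sym (trans-inst₂ A B)) (∀₂E (translate ρ χ d) (trans ρ χ B))
  translate ρ χ (eqR A d u≈v) =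
    subst (Derivation E _) (sym (trans-substF A))
      (eqR (trans ρ χ A) (subst (Derivation E _) (trans-substF A) (translate ρ χ d)) u≈v)
  translate ρ χ (dne k) = dneAxiom-translation k _
  translate ρ χ (∀cI {Γ = Γ} d) =
    ∀₂I (subst (λ Γ' → Derivation E Γ' _) (map-square trans-wkC Γ)
               (translate (λ x → there (ρ x)) (liftV χ) d))
  translate ρ χ (∀cE {A = A} d B cB) =
    ⇒E (proj₁ (≅-equivalent (trans-instC A B cB)) _)
       (∀₂E (translate ρ χ d) (¬' (trans ρ χ B)))

open Soundness

theorem3p2 : (S : Signature) (E : EqTheory S) {n : _} {Δ Θ : List _}
    (Γ : List (Formula S M n Δ Θ)) (A : Formula S M n Δ Θ) →
    Derivation E Γ A → Derivation E (map _* Γ) (A *)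
theorem3p2 S E {Δ = Δ} {Θ} Γ A = translate E (inr {Θ} {Δ}) (inl {Θ} {Δ})
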